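{- Let $\mathsf{DS}$ be the sentence $\exists x\top\wedge\forall x\,\Diamond F(x)\wedge\forall x\exists y\big((F(x)\vee F(y))>\neg F(x)\big)$, where $F$ is a unary predicate. Then for every weakly Stalnakerian selection frame, every model on it, and every world $w$ of the model, $\mathsf{DS}$ is not true at $w$.
   Context: Language: formulas built from atomic predications $P^n(x_1,\dots,x_n)$ with $\neg$, $\supset$, a binary conditional $>$, and $\forall x$; $\wedge,\vee,\top,\bot,\exists$ defined as usual; $\Diamond\phi:=\neg(\phi>\bot)$. A selection frame is $\langle W,R,f,D,d\rangle$ with $W\neq\varnothing$, $R\subseteq W\times W$, $f:\mathcal{P}(W)\times W\to\mathcal{P}(W)$ with $f(P,w)\subseteq R(w):=\{v: wRv\}$, $D\neq\varnothing$, and $d:W\to\mathcal{P}(D)$ (local domains may be empty). It is weakly Stalnakerian if for all $P,Q\subseteq W$, $w\in W$: $f(P,w)\subseteq P$; $w\in P$ implies $w\in f(P,w)$; if $f(P,w)\subseteq Q$ and $f(Q,w)\subseteq P$ then $f(P,w)=f(Q,w)$; and $|f(P,w)|\le1$. A model adds $I$ with $I(P^n,w)\subseteq D^n$. With assignments $g$ of variables to $D$ ($g^x_a$ the variant sending $x$ to $a$): atomic truth via $I$; $\neg,\supset$ classical; $w,g\Vdash\forall x\phi$ iff $w,g^x_a\Vdash\phi$ for all $a\in d(w)$; $w,g\Vdash\phi>\psi$ iff $f([\phi]^g,w)\subseteq[\psi]^g$, where $[\phi]^g=\{v: v,g\Vdash\phi\}$. A sentence is true at $w$ if it holds at $w$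 under every (equivalently some) assignment. -}

module Defs where

open import Data.Nat using (ℕ; zero; suc)
open import Data.Vec using (Vec; []; _∷_; map)
open import Data.Product using (Σ; _×_; _,_)
open import Data.Empty using (⊥)
open import Relation.Nullary using (¬_)
open import Relation.Binary.PropositionalEquality using (_≡_)
open import Function.Bundles using (_⇔_)

-- Syntax
-- Variables are natural numbers; the predicate letter P^n_k has arity n
-- and index k.

Var : Set
Var = ℕ

infixr 5 _⊃_
infixr 4 _>_

data Fm : Set where
  atom : (n k : ℕ) → Vec Var n → Fm
  ¬'   : Fm → Fm
  _⊃_  : Fm → Fm → Fm
  _>_  : Fm → Fm → Fm
  ∀'   : Var → Fm → Fm

⊤' : Fm
⊤' = atom 0 0 [] ⊃ atom 0 0 []

⊥' : Fm
⊥' = ¬' ⊤'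

_∧'_ : Fm → Fm → Fm
φ ∧' ψ = ¬' (φ ⊃ ¬' ψ)

_∨'_ : Fm → Fm → Fm
φ ∨' ψ = ¬' φ ⊃ ψ

∃' : Var → Fm → Fm
∃' x φ = ¬' (∀' x (¬' φ))

◇ : Fm → Fm
◇ φ = ¬' (φ > ⊥')

Pow : Set → Set₁
Pow A = A → Set

_⊆_ : {A : Set} → Pow A → Pow A → Set
P ⊆ Q = ∀ v → P v → Q v

record SelectionFrame : Set₁ where
  field
    W    : Set
    w₀   : W
    R    : W → W → Set
    f    : Pow W → W → Pow W
    D    : Set
    a₀   : D
    d    : W → Pow D                  -- local domains (may be empty)
    f⊆R  : ∀ P w → f P w ⊆ R w
    -- f is a function on subsets: extensionally equal arguments give
    -- extensionally equal values
    f-ext : ∀ P Q w → (∀ v → P v ⇔ Q v) → ∀ v → f P w v ⇔ f Q w v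

record WeaklyStalnakerian (F : SelectionFrame) : Set₁ where
  open SelectionFrame F
  field
    success   : ∀ P w → f P w ⊆ P
    centering : ∀ P w → P w → f P w w
    uniform   : ∀ P Q w → f P w ⊆ Q → f Q w ⊆ P →
                (f P w ⊆ f Q w) × (f Q w ⊆ f P w)
    atMostOne : ∀ P w u v → f P w u → f P w v → u ≡ v

record Model : Set₁ where
  field
    frame : SelectionFrame
  open SelectionFrame frame public
  field
    I : (n k : ℕ) → W → Vec D n → Set

module Semantics (M : Model) where
  open Model M

  Assignment : Set
  Assignment = Var → D

  _[_↦_] : Assignment → Var → D → Assignment
  (g [ x ↦ a ]) y with x Data.Nat.≟ y
  ... | Relation.Nullary.yes _ = a
  ... | Relation.Nullary.no _  = g y

  _,_⊩_ : W → Assignment → Fm → Set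
  w , g ⊩ atom n k xs = I n k w (map g xs)
  w , g ⊩ ¬' φ        = ¬ (w , g ⊩ φ)
  w , g ⊩ (φ ⊃ ψ)     = w , g ⊩ φ → w , g ⊩ ψ
  w , g ⊩ (φ > ψ)     = f (λ v → v , g ⊩ φ) w ⊆ (λ v → v , g ⊩ ψ)
  w , g ⊩ ∀' x φ      = ∀ a → d w a → w , (g [ x ↦ a ]) ⊩ φ

  TrueAt : W → Fm → Set
  TrueAt w φ = ∀ g → w , g ⊩ φ

-- The sentence DS, with F = P^1_0, x = variable 0, y = variable 1

Fx : Fm
Fx = atom 1 0 (0 ∷ [])

Fy : Fm
Fy = atom 1 0 (1 ∷ [])

DS : Fm
DS = ∃' 0 ⊤' ∧' (∀' 0 (◇ Fx) ∧' ∀' 0 (∃' 1 ((Fx ∨' Fy) > ¬' Fx)))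

{-# OPTIONS --safe #-}
-- Let P be the union of the extensions of F(a), a ∈ d(w). Each of these is
-- possible, so by uniformity the selection f(P, w) is non-empty too, and being a
-- singleton it is some world u with F(a') at u. The third conjunct gives b with
-- f(F(a') ∪ F(b), w) ⊆ ¬F(a'). Since u lies in F(a') ∪ F(b) ⊆ P, uniformity
-- makes f(P, w) and f(F(a') ∪ F(b), w) coincide, so u satisfies ¬F(a').
module Submission where

open import Defs
open import Data.Vec using ([]; _∷_)
open import Data.Product using (Σ; ∃; _,_; proj₁)
open import Data.Empty using (⊥-elim)
open import Function using (_∘_)
open import Relation.Nullary using (¬_; contradiction)
open import Relation.Unary using (Empty; ∁; ⋃)
open import Relation.Binary.PropositionalEquality using (subst)

-- Union in the sense of the defined disjunction φ ∨' ψ = ¬' φ ⊃ ψ.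
_∪ᶜ_ : {A : Set} → Pow A → Pow A → Pow A
(P ∪ᶜ Q) v = ¬ P v → Q v

module WeaklyStalnakerianFrame {F : SelectionFrame} (S : WeaklyStalnakerian F) where
  open SelectionFrame F
  open WeaklyStalnakerian S

  selection-empty-antitone : ∀ {P Q} w → P ⊆ Q → Empty (f Q w) → Empty (f P w)
  selection-empty-antitone {P} {Q} w P⊆Q fQ-empty v fPv =
    fQ-empty v (proj₁ (uniform P Q w fP⊆Q fQ⊆P) v fPv)
    where
    fP⊆Q : f P w ⊆ Q
    fP⊆Q u = P⊆Q u ∘ success P w u
    fQ⊆P : f Q w ⊆ P
    fQ⊆P u = ⊥-elim ∘ fQ-empty u

  selection-⊆ : ∀ {P Q} w {u} → f P w u → Q u → f P w ⊆ Q
  selection-⊆ {P} {Q} w fPu Qu v fPv = subst Q (atMostOne P w _ _ fPu fPv) Qu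

  selection-restrict : ∀ {P Q} w {u} → f P w u → Q u → f Q w ⊆ P → f Q w u
  selection-restrict {P} {Q} w fPu Qu fQ⊆P =
    proj₁ (uniform P Q w (selection-⊆ w fPu Qu) fQ⊆P) _ fPu

  selection-∪ᶜ-avoiding : ∀ {P Q} w → f (P ∪ᶜ Q) w ⊆ ∁ P → f (P ∪ᶜ Q) w ⊆ Q
  selection-∪ᶜ-avoiding {P} {Q} w avoids v fv = success (P ∪ᶜ Q) w v fv (avoids v fv)

  no-evasive-family : {ι : Set} (Fᵢ : ι → Pow W) (w : W) →
    ¬ ¬ ι →
    (∀ i → ¬ Empty (f (Fᵢ i) w)) →
    ¬ (∀ i → ¬ ¬ Σ ι λ j → f (Fᵢ i ∪ᶜ Fᵢ j) w ⊆ ∁ (Fᵢ i))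
  no-evasive-family {ι} Fᵢ w inhabited possible evasive = ⋃-possible ⋃-impossible
    where
    ⋃-possible : ¬ Empty (f (⋃ ι Fᵢ) w)
    ⋃-possible f⋃-empty =
      inhabited λ i → possible i (selection-empty-antitone w (λ _ → i ,_) f⋃-empty)

    ⋃-impossible : Empty (f (⋃ ι Fᵢ) w)
    ⋃-impossible u f⋃u with success (⋃ ι Fᵢ) w u f⋃u
    ... | i , Fᵢu = evasive i λ (j , avoids) →
      let f∪ᶜ⊆⋃ : f (Fᵢ i ∪ᶜ Fᵢ j) w ⊆ ⋃ ι Fᵢ
          f∪ᶜ⊆⋃ v fv = j , selection-∪ᶜ-avoiding w avoids v fv
      in avoids u (selection-restrict w f⋃u (contradiction Fᵢu) f∪ᶜ⊆⋃) Fᵢu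

module DS-Truth (M : Model) {w : Model.W M} {g : Semantics.Assignment M}
                (ds : Semantics._,_⊩_ M w g DS) where
  open Model M
  open Semantics M

  Fᵈ : ∃ (d w) → Pow W
  Fᵈ (a , _) v = I 1 0 v (a ∷ [])

  -- Each conjunct of φ ∧' ψ = ¬' (φ ⊃ ¬' ψ), and each ∃', is used by refuting it.
  DS-inhabited : ¬ ¬ ∃ (d w)
  DS-inhabited k = ds λ ∃⊤ _ → ∃⊤ λ a da _ → k (a , da)

  DS-possible : ∀ a → ¬ Empty (f (Fᵈ a) w)
  DS-possible (a , da) fF-empty =
    ds λ _ rest → rest λ ∀◇F _ → ∀◇F a da λ v → ⊥-elim ∘ fF-empty v

  DS-evasive : ∀ a → ¬ ¬ Σ (∃ (d w)) λ b → f (Fᵈ a ∪ᶜ Fᵈ b) w ⊆ ∁ (Fᵈ a)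
  DS-evasive (a , da) k =
    ds λ _ rest → rest λ _ ∀∃ → ∀∃ a da λ b db evaded → k ((b , db) , evaded)

proposition4p2 : (M : Model) → WeaklyStalnakerian (Model.frame M) →
    (w : Model.W M) → ¬ Semantics.TrueAt M w DS
proposition4p2 M S w T = no-evasive-family Fᵈ w DS-inhabited DS-possible DS-evasive
  where
  open WeaklyStalnakerianFrame S
  g₀ : Semantics.Assignment M
  g₀ _ = Model.a₀ M
  open DS-Truth M {w} {g₀} (T g₀)
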